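{- Let $T$ be a full binary tree of height $h$, and let $t = (h+1) \bmod 3$. Then $\mathrm{cdn}(T) = \dfrac{2^{h+1}-2^t}{7}$.
   Context: A claw is $K_{1,3}$. $\mathrm{cdn}(G)$ is the minimum number of vertices whose deletion from $G$ leaves a graph with no induced $K_{1,3}$. A full $k$-ary tree is a rooted tree in which every node has either zero or exactly $k$ children and all leaves have the same depth; its height is the depth of its leaves (the depth of a vertex being its distance to the root). A full binary tree is a full $2$-ary tree. -}

module Defs where

open import Data.Nat using (ℕ; _+_; _*_; _∸_; _^_; _≤_)
open import Data.Fin using (Fin; toℕ)
open import Data.Fin.Subset using (Subset; _∉_; ∣_∣)
open import Data.Product using (Σ; _×_; ∃)
open import Data.Sum using (_⊎_)
open import Relation.Binary.PropositionalEquality using (_≡_; _≢_)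
open import Relation.Nullary using (¬_)

Graph : ℕ → Set₁
Graph n = Fin n → Fin n → Set

record InducedClawAvoiding {n : ℕ} (G : Graph n) (S : Subset n) : Set where
  field
    c a b d : Fin n
    c∉S : c ∉ S
    a∉S : a ∉ S
    b∉S : b ∉ S
    d∉S : d ∉ S
    c≢a : c ≢ a
    c≢b : c ≢ b
    c≢d : c ≢ d
    a≢b : a ≢ b
    a≢d : a ≢ d
    b≢d : b ≢ d
    ca : G c a
    cb : G c b
    cd : G c d
    ¬ab : ¬ G a b
    ¬ad : ¬ G a d
    ¬bd : ¬ G b d

IsClawDeletionSet : {n : ℕ} → Graph n → Subset n → Set
IsClawDeletionSet G S = ¬ InducedClawAvoiding G S

IsCdn : {n : ℕ} → Graph n → ℕ → Set
IsCdn {n} G m =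
  (Σ (Subset n) λ S → IsClawDeletionSet G S × ∣ S ∣ ≡ m)
  × ((S : Subset n) → IsClawDeletionSet G S → m ≤ ∣ S ∣)

-- The full binary tree of height h, in heap numbering: vertices 0 .. 2^(h+1) - 2,
-- root 0, the children of vertex i are 2i+1 and 2i+2.
binTreeSize : ℕ → ℕ
binTreeSize h = 2 ^ (h + 1) ∸ 1

ChildOf : {n : ℕ} → Fin n → Fin n → Set
ChildOf p x = (toℕ x ≡ 2 * toℕ p + 1) ⊎ (toℕ x ≡ 2 * toℕ p + 2)

FullBinaryTree : (h : ℕ) → Graph (binTreeSize h)
FullBinaryTree h x y = ChildOf x y ⊎ ChildOf y x

-- Let r be the residue of h + 1 modulo 3 and S the set of vertices whose depth is congruent to r,
-- i.e. the levels h − 2, h − 5, …, which contain 2^(h−2) + 2^(h−5) + … = (2^(h+1) − 2^t)/7 vertices.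
-- The centre of a claw has at most two children and only one parent, so a claw contains its centre,
-- the parent of the centre and a child of the centre: three consecutive levels, one of which lies
-- in S.  Conversely every u ∈ S has depth at most h − 2, so u, its left child c and the two children
-- of c form an induced claw C_u.  Every vertex of C_u has u as its nearest ancestor-or-self on a
-- level congruent to r, so the claws C_u are pairwise disjoint and every claw-deletion set has at
-- least |S| vertices.

module Submission where

open import Defs
open import Data.Nat hiding (∣_-_∣)
open import Data.Nat.Properties
open import Data.Nat.Logarithm
open import Data.Nat.Induction using (<-rec)
open import Data.Nat.DivMod using (_%_; _/_; [m+n]%n≡m%n; m*n/n≡m)
open import Data.Nat.Tactic.RingSolver using (solve-∀)
open import Data.Bool using (Bool; true; false; if_then_else_)
open import Data.Nat.GeneralisedArithmetic using (iterate)
open import Data.Product using (∃-syntax; _×_; _,_)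
open import Data.Sum using (_⊎_; inj₁; inj₂; [_,_])
open import Data.Empty using (⊥; ⊥-elim)
open import Data.Fin using (Fin; zero; suc; toℕ; fromℕ<)
open import Data.Fin.Properties using (toℕ-injective; toℕ-fromℕ<; toℕ<n)
import Data.Fin.Properties as Finₚ
open import Data.Fin.Subset using (Subset; inside; outside; _∈_; _∉_; ⁅_⁆; _-_; ∣_∣)
open import Data.Fin.Subset.Properties
  using (_∈?_; x∈p∧x∉q⇒x∈p─q; x≢y⇒x∉⁅y⁆; p⊂q⇒∣p∣<∣q∣; p∩q≢∅⇒p─q⊂p; x∈p∩q⁺; x∈⁅x⁆)
open import Data.Vec using ([]; _∷_; here; there; tabulate)
open import Data.Vec.Properties using (lookup∘tabulate; []=⇒lookup; lookup⇒[]=)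
open import Function.Definitions using (Injective)
open import Function using (_∘_; case_of_)
open import Relation.Binary.PropositionalEquality hiding ([_])
open import Relation.Nullary using (¬_; contradiction; yes; no; does)
open import Relation.Unary using (Pred; Decidable)
open import Level using (0ℓ)
open import Relation.Nullary.Decidable using (dec-true; dec-false)

-- Binary logarithm

2*n≡n+n : ∀ n → 2 * n ≡ n + n
2*n≡n+n n = cong (n +_) (+-identityʳ n)

2*⌊n/2⌋≤n : ∀ n → 2 * ⌊ n /2⌋ ≤ n
2*⌊n/2⌋≤n n = begin
  2 * ⌊ n /2⌋          ≡⟨ 2*n≡n+n ⌊ n /2⌋ ⟩
  ⌊ n /2⌋ + ⌊ n /2⌋    ≤⟨ +-monoʳ-≤ ⌊ n /2⌋ (⌊n/2⌋≤⌈n/2⌉ n) ⟩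
  ⌊ n /2⌋ + ⌈ n /2⌉    ≡⟨ ⌊n/2⌋+⌈n/2⌉≡n n ⟩
  n                    ∎
  where open ≤-Reasoning

2^m<2^n⇒m<n : ∀ {m n} → 2 ^ m < 2 ^ n → m < n
2^m<2^n⇒m<n {m} {n} 2^m<2^n = ≰⇒> λ n≤m → <⇒≱ 2^m<2^n (^-monoʳ-≤ 2 n≤m)

⌊log₂n⌋≡1+⌊log₂⌊n/2⌋⌋ : ∀ n → 2 ≤ n → ⌊log₂ n ⌋ ≡ suc ⌊log₂ ⌊ n /2⌋ ⌋
⌊log₂n⌋≡1+⌊log₂⌊n/2⌋⌋ n 2≤n = begin
  ⌊log₂ n ⌋                ≡⟨ suc-pred ⌊log₂ n ⌋ {{>-nonZero 0<⌊log₂n⌋}} ⟨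
  suc (⌊log₂ n ⌋ ∸ 1)      ≡⟨ cong suc (⌊log₂⌊n/2⌋⌋≡⌊log₂n⌋∸1 n) ⟨
  suc ⌊log₂ ⌊ n /2⌋ ⌋      ∎
  where
  open ≡-Reasoning
  0<⌊log₂n⌋ : 0 < ⌊log₂ n ⌋
  0<⌊log₂n⌋ = subst (_≤ ⌊log₂ n ⌋) (⌊log₂[2^n]⌋≡n 1) (⌊log₂⌋-mono-≤ 2≤n)

2^⌊log₂n⌋≤n : ∀ n → 1 ≤ n → 2 ^ ⌊log₂ n ⌋ ≤ n
2^⌊log₂n⌋≤n = <-rec (λ n → 1 ≤ n → 2 ^ ⌊log₂ n ⌋ ≤ n) step
  where
  step : ∀ n → (∀ {m} → m < n → 1 ≤ m → 2 ^ ⌊log₂ m ⌋ ≤ m) → 1 ≤ n → 2 ^ ⌊log₂ n ⌋ ≤ n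
  step 1 _ _ = subst (λ k → 2 ^ k ≤ 1) (sym (⌊log₂[2^n]⌋≡n 0)) ≤-refl
  step n@(suc (suc m)) rec _ = begin
    2 ^ ⌊log₂ n ⌋                 ≡⟨ cong (2 ^_) (⌊log₂n⌋≡1+⌊log₂⌊n/2⌋⌋ n (s≤s (s≤s z≤n))) ⟩
    2 * 2 ^ ⌊log₂ ⌊ n /2⌋ ⌋       ≤⟨ *-monoʳ-≤ 2 (rec (⌊n/2⌋<n (suc m)) (s≤s z≤n)) ⟩
    2 * ⌊ n /2⌋                   ≤⟨ 2*⌊n/2⌋≤n n ⟩
    n                             ∎
    where open ≤-Reasoning

n<2^[1+⌊log₂n⌋] : ∀ n → n < 2 ^ suc ⌊log₂ n ⌋
n<2^[1+⌊log₂n⌋] n = ≰⇒> λ 2^[1+⌊log₂n⌋]≤n →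
  1+n≰n (subst (_≤ ⌊log₂ n ⌋) (⌊log₂[2^n]⌋≡n _) (⌊log₂⌋-mono-≤ 2^[1+⌊log₂n⌋]≤n))

n<2^k⇒⌊log₂n⌋<k : ∀ {n k} → 1 ≤ n → n < 2 ^ k → ⌊log₂ n ⌋ < k
n<2^k⇒⌊log₂n⌋<k 1≤n n<2^k = 2^m<2^n⇒m<n (≤-<-trans (2^⌊log₂n⌋≤n _ 1≤n) n<2^k)

2^k≤n⇒k≤⌊log₂n⌋ : ∀ {n k} → 2 ^ k ≤ n → k ≤ ⌊log₂ n ⌋
2^k≤n⇒k≤⌊log₂n⌋ 2^k≤n = subst (_≤ _) (⌊log₂[2^n]⌋≡n _) (⌊log₂⌋-mono-≤ 2^k≤n)

2^k≤n<2^[1+k]⇒⌊log₂n⌋≡k : ∀ {n k} → 2 ^ k ≤ n → n < 2 ^ suc k → ⌊log₂ n ⌋ ≡ k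
2^k≤n<2^[1+k]⇒⌊log₂n⌋≡k {k = k} lo hi =
  ≤-antisym (m<1+n⇒m≤n (n<2^k⇒⌊log₂n⌋<k (≤-trans (m^n>0 2 k) lo) hi)) (2^k≤n⇒k≤⌊log₂n⌋ lo)

-- Heap numbering of the full binary tree

-- For p x : Fin n, ChildOf p x is definitionally IsChild (toℕ p) (toℕ x).
IsChild : ℕ → ℕ → Set
IsChild p x = x ≡ 2 * p + 1 ⊎ x ≡ 2 * p + 2

2*n+k≡k+[n+n] : ∀ n k → 2 * n + k ≡ k + (n + n)
2*n+k≡k+[n+n] n k = trans (+-comm (2 * n) k) (cong (k +_) (2*n≡n+n n))

⌊1+n+n/2⌋≡n : ∀ n → ⌊ suc (n + n) /2⌋ ≡ n
⌊1+n+n/2⌋≡n zero    = refl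
⌊1+n+n/2⌋≡n (suc n) = cong suc (trans (cong ⌊_/2⌋ (+-suc n n)) (⌊1+n+n/2⌋≡n n))

⌈child/2⌉≡1+parent : ∀ p {x} → IsChild p x → ⌈ x /2⌉ ≡ suc p
⌈child/2⌉≡1+parent p (inj₁ refl) =
  trans (cong ⌈_/2⌉ (2*n+k≡k+[n+n] p 1)) (cong suc (sym (n≡⌊n+n/2⌋ p)))
⌈child/2⌉≡1+parent p (inj₂ refl) =
  trans (cong ⌈_/2⌉ (2*n+k≡k+[n+n] p 2)) (cong suc (⌊1+n+n/2⌋≡n p))

parent : ℕ → ℕ
parent x = pred ⌈ x /2⌉

parent-child : ∀ p {x} → IsChild p x → parent x ≡ p
parent-child p = cong pred ∘ ⌈child/2⌉≡1+parent p

parent-unique : ∀ p q {x} → IsChild p x → IsChild q x → p ≡ q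
parent-unique p q p→x q→x = trans (sym (parent-child p p→x)) (parent-child q q→x)

at-most-two-children : ∀ c {x y z} → IsChild c x → IsChild c y → IsChild c z → x ≡ y ⊎ x ≡ z ⊎ y ≡ z
at-most-two-children _ (inj₁ x≡) (inj₁ y≡) _         = inj₁ (trans x≡ (sym y≡))
at-most-two-children _ (inj₂ x≡) (inj₂ y≡) _         = inj₁ (trans x≡ (sym y≡))
at-most-two-children _ (inj₁ x≡) (inj₂ _)  (inj₁ z≡) = inj₂ (inj₁ (trans x≡ (sym z≡)))
at-most-two-children _ (inj₂ x≡) (inj₁ _)  (inj₂ z≡) = inj₂ (inj₁ (trans x≡ (sym z≡)))
at-most-two-children _ (inj₁ _)  (inj₂ y≡) (inj₂ z≡) = inj₂ (inj₂ (trans y≡ (sym z≡)))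
at-most-two-children _ (inj₂ _)  (inj₁ y≡) (inj₁ z≡) = inj₂ (inj₂ (trans y≡ (sym z≡)))

depth : ℕ → ℕ
depth x = ⌊log₂ suc x ⌋

depth-child : ∀ p {x} → IsChild p x → depth x ≡ suc (depth p)
depth-child p {zero}  p→x = case ⌈child/2⌉≡1+parent p p→x of λ ()
depth-child p {suc x} p→x = trans (⌊log₂n⌋≡1+⌊log₂⌊n/2⌋⌋ (2 + x) (s≤s (s≤s z≤n)))
                                    (cong (suc ∘ ⌊log₂_⌋) (⌈child/2⌉≡1+parent p p→x))

module _ {n : ℕ} where

  Adjacent : Fin n → Fin n → Set
  Adjacent x y = ChildOf x y ⊎ ChildOf y x

  parent-and-child-among : ∀ {c x y z : Fin n} (Q : Fin n → Set) →
    Adjacent c x → Adjacent c y → Adjacent c z → x ≢ y → x ≢ z → y ≢ z → Q x → Q y → Q z →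
    (∃[ p ] ChildOf p c × Q p) × (∃[ w ] ChildOf c w × Q w)
  parent-and-child-among {x = x} {y} Q (inj₂ x→c) (inj₂ y→c) _ x≢y _ _ _ _ _ =
    contradiction (toℕ-injective (parent-unique (toℕ x) (toℕ y) x→c y→c)) x≢y
  parent-and-child-among {x = x} {y} Q (inj₂ x→c) (inj₁ c→y) _ _ _ _ Qx Qy _ =
    (x , x→c , Qx) , (y , c→y , Qy)
  parent-and-child-among {x = x} {y} Q (inj₁ c→x) (inj₂ y→c) _ _ _ _ Qx Qy _ =
    (y , y→c , Qy) , (x , c→x , Qx)
  parent-and-child-among {x = x} {z = z} Q (inj₁ c→x) (inj₁ _) (inj₂ z→c) _ _ _ Qx _ Qz =
    (z , z→c , Qz) , (x , c→x , Qx)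
  parent-and-child-among {c} Q (inj₁ c→x) (inj₁ c→y) (inj₁ c→z) x≢y x≢z y≢z _ _ _ =
    ⊥-elim ([ x≢y ∘ toℕ-injective , [ x≢z ∘ toℕ-injective , y≢z ∘ toℕ-injective ] ]
              (at-most-two-children (toℕ c) c→x c→y c→z))

  depth-gap⇒≢ : ∀ {x y : Fin n} k → depth (toℕ y) ≡ suc k + depth (toℕ x) → x ≢ y
  depth-gap⇒≢ {x} k y-deeper refl = m≢1+n+m (depth (toℕ x)) y-deeper

  depth-gap⇒¬adjacent : ∀ {x y : Fin n} k → depth (toℕ y) ≡ k + depth (toℕ x) → k ≢ 1 → ¬ Adjacent x y
  depth-gap⇒¬adjacent {x} k y-deeper k≢1 (inj₁ x→y) =
    k≢1 (+-cancelʳ-≡ (depth (toℕ x)) k 1 (trans (sym y-deeper) (depth-child (toℕ x) x→y)))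
  depth-gap⇒¬adjacent {x} {y} k y-deeper k≢1 (inj₂ y→x) =
    m≢1+n+m (depth (toℕ y)) (trans y-deeper (trans (cong (k +_) (depth-child (toℕ y) y→x)) (+-suc k _)))

  parent-and-grandchildren-claw : ∀ {S : Subset n} {a c b d : Fin n} →
    ChildOf a c → ChildOf c b → ChildOf c d → b ≢ d →
    a ∉ S → c ∉ S → b ∉ S → d ∉ S → InducedClawAvoiding Adjacent S
  parent-and-grandchildren-claw {a = a} {c} {b} {d} a→c c→b c→d b≢d a∉S c∉S b∉S d∉S = record
    { c = c ; a = a ; b = b ; d = d
    ; c∉S = c∉S ; a∉S = a∉S ; b∉S = b∉S ; d∉S = d∉S
    ; c≢a = ≢-sym (depth-gap⇒≢ 0 c-depth)
    ; c≢b = depth-gap⇒≢ 0 (depth-child (toℕ c) c→b)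
    ; c≢d = depth-gap⇒≢ 0 (depth-child (toℕ c) c→d)
    ; a≢b = depth-gap⇒≢ 1 b-depth
    ; a≢d = depth-gap⇒≢ 1 d-depth
    ; b≢d = b≢d
    ; ca = inj₂ a→c ; cb = inj₁ c→b ; cd = inj₁ c→d
    ; ¬ab = depth-gap⇒¬adjacent 2 b-depth λ ()
    ; ¬ad = depth-gap⇒¬adjacent 2 d-depth λ ()
    ; ¬bd = depth-gap⇒¬adjacent 0 (trans d-depth (sym b-depth)) λ ()
    }
    where
    c-depth : depth (toℕ c) ≡ suc (depth (toℕ a))
    c-depth = depth-child (toℕ a) a→c
    b-depth : depth (toℕ b) ≡ 2 + depth (toℕ a)
    b-depth = trans (depth-child (toℕ c) c→b) (cong suc c-depth)
    d-depth : depth (toℕ d) ≡ 2 + depth (toℕ a)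
    d-depth = trans (depth-child (toℕ c) c→d) (cong suc c-depth)

some-member-of-four : ∀ {n} {S : Subset n} {w x y z : Fin n} →
  (w ∉ S → x ∉ S → y ∉ S → z ∉ S → ⊥) → (Q : Fin n → Set) → Q w × Q x × Q y × Q z → ∃[ v ] v ∈ S × Q v
some-member-of-four {S = S} {w} {x} {y} {z} not-all-out Q (Qw , Qx , Qy , Qz)
  with w ∈? S | x ∈? S | y ∈? S | z ∈? S
... | yes w∈S | _       | _       | _       = w , w∈S , Qw
... | no _    | yes x∈S | _       | _       = x , x∈S , Qx
... | no _    | no _    | yes y∈S | _       = y , y∈S , Qy
... | no _    | no _    | no _    | yes z∈S = z , z∈S , Qz
... | no w∉S  | no x∉S  | no y∉S  | no z∉S  = ⊥-elim (not-all-out w∉S x∉S y∉S z∉S)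

2^[h+1]≡2^[1+h] : ∀ h → 2 ^ (h + 1) ≡ 2 ^ suc h
2^[h+1]≡2^[1+h] h = cong (2 ^_) (+-comm h 1)

<binTreeSize⇒depth≤ : ∀ h {x} → x < binTreeSize h → depth x ≤ h
<binTreeSize⇒depth≤ h {x} x<size = m<1+n⇒m≤n (n<2^k⇒⌊log₂n⌋<k (s≤s z≤n)
  (subst (suc x <_) (2^[h+1]≡2^[1+h] h) (m≤pred[n]⇒suc[m]≤n {{m^n≢0 2 (h + 1)}} x<size)))

depth≤⇒<binTreeSize : ∀ h x → depth x ≤ h → x < binTreeSize h
depth≤⇒<binTreeSize h x depth≤h = suc[m]≤n⇒m≤pred[n] (begin
  suc (suc x)            ≤⟨ n<2^[1+⌊log₂n⌋] (suc x) ⟩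
  2 ^ suc (depth x)      ≤⟨ ^-monoʳ-≤ 2 (s≤s depth≤h) ⟩
  2 ^ suc h              ≡⟨ 2^[h+1]≡2^[1+h] h ⟨
  2 ^ (h + 1)            ∎)
  where open ≤-Reasoning

depth-on-level : ∀ k x → x < 2 ^ k → depth ((2 ^ k ∸ 1) + x) ≡ k
depth-on-level k x x<2^k = 2^k≤n<2^[1+k]⇒⌊log₂n⌋≡k
  (subst (2 ^ k ≤_) (sym 1+[2^k∸1+x]≡2^k+x) (m≤m+n (2 ^ k) x))
  (subst (_< 2 ^ suc k) (sym 1+[2^k∸1+x]≡2^k+x)
    (subst (2 ^ k + x <_) (sym (2*n≡n+n (2 ^ k))) (+-monoʳ-< (2 ^ k) x<2^k)))
  where
  1+[2^k∸1+x]≡2^k+x : suc ((2 ^ k ∸ 1) + x) ≡ 2 ^ k + x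
  1+[2^k∸1+x]≡2^k+x = cong (_+ x) (suc-pred (2 ^ k) {{m^n≢0 2 k}})

-- Levels modulo 3

next₃ : Fin 3 → Fin 3
next₃ zero             = suc zero
next₃ (suc zero)       = suc (suc zero)
next₃ (suc (suc zero)) = zero

residue₃ : ℕ → Fin 3
residue₃ zero    = zero
residue₃ (suc n) = next₃ (residue₃ n)

next₃³≡id : ∀ x → next₃ (next₃ (next₃ x)) ≡ x
next₃³≡id zero             = refl
next₃³≡id (suc zero)       = refl
next₃³≡id (suc (suc zero)) = refl

next₃x≢x : ∀ x → next₃ x ≢ x
next₃x≢x zero             ()
next₃x≢x (suc zero)       ()
next₃x≢x (suc (suc zero)) ()

next₃²x≢x : ∀ x → next₃ (next₃ x) ≢ x
next₃²x≢x zero             ()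
next₃²x≢x (suc zero)       ()
next₃²x≢x (suc (suc zero)) ()

one-of-three-hits : ∀ x r → x ≡ r ⊎ next₃ x ≡ r ⊎ next₃ (next₃ x) ≡ r
one-of-three-hits zero             zero             = inj₁ refl
one-of-three-hits zero             (suc zero)       = inj₂ (inj₁ refl)
one-of-three-hits zero             (suc (suc zero)) = inj₂ (inj₂ refl)
one-of-three-hits (suc zero)       zero             = inj₂ (inj₂ refl)
one-of-three-hits (suc zero)       (suc zero)       = inj₁ refl
one-of-three-hits (suc zero)       (suc (suc zero)) = inj₂ (inj₁ refl)
one-of-three-hits (suc (suc zero)) zero             = inj₂ (inj₁ refl)
one-of-three-hits (suc (suc zero)) (suc zero)       = inj₂ (inj₂ refl)
one-of-three-hits (suc (suc zero)) (suc (suc zero)) = inj₁ refl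

-- (x − r) mod 3; the summand 3 avoids truncated subtraction.
lag : Fin 3 → Fin 3 → ℕ
lag x r = (3 + toℕ x ∸ toℕ r) % 3

lag-next₃ : ∀ r → lag r r ≡ 0 × lag (next₃ r) r ≡ 1 × lag (next₃ (next₃ r)) r ≡ 2
lag-next₃ zero             = refl , refl , refl
lag-next₃ (suc zero)       = refl , refl , refl
lag-next₃ (suc (suc zero)) = refl , refl , refl

residue₃-gap : ∀ {d h} → d ≤ h → residue₃ d ≡ residue₃ (suc h) → 2 + d ≤ h
residue₃-gap {d} d≤h same = ≤∧≢⇒< (≤∧≢⇒< d≤h d≢h) 1+d≢h
  where
  d≢h : d ≢ _
  d≢h refl = next₃x≢x (residue₃ d) (sym same)
  1+d≢h : suc d ≢ _
  1+d≢h refl = next₃²x≢x (residue₃ d) (sym same)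

-- The nearest ancestor of x, or x itself, whose depth has residue r.
anchor : Fin 3 → ℕ → ℕ
anchor r x = iterate parent x (lag (residue₃ (depth x)) r)

anchor-of-claw : ∀ {r} u {c x y} → residue₃ (depth u) ≡ r → IsChild u c → IsChild c x → IsChild c y →
  anchor r u ≡ u × anchor r c ≡ u × anchor r x ≡ u × anchor r y ≡ u
anchor-of-claw {r} u {c} u→c-level u→c c→x c→y with u→c-level | lag-next₃ r
... | refl | lag-u , lag-c , lag-grandchild =
  anchor-u , anchor-c , anchor-grandchild c→x , anchor-grandchild c→y
  where
  depth-c : depth c ≡ suc (depth u)
  depth-c = depth-child u u→c
  anchor-u : anchor r u ≡ u
  anchor-u = cong (iterate parent u) lag-u
  anchor-c : anchor r c ≡ u
  anchor-c = begin
    iterate parent c (lag (residue₃ (depth c)) r)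
      ≡⟨ cong (λ d → iterate parent c (lag (residue₃ d) r)) depth-c ⟩
    iterate parent c (lag (next₃ r) r)              ≡⟨ cong (iterate parent c) lag-c ⟩
    parent c                                        ≡⟨ parent-child u u→c ⟩
    u                                               ∎
    where open ≡-Reasoning
  anchor-grandchild : ∀ {x} → IsChild c x → anchor r x ≡ u
  anchor-grandchild {x} c→x = begin
    iterate parent x (lag (residue₃ (depth x)) r)
      ≡⟨ cong (λ d → iterate parent x (lag (residue₃ d) r))
              (trans (depth-child c c→x) (cong suc depth-c)) ⟩
    iterate parent x (lag (next₃ (next₃ r)) r)        ≡⟨ cong (iterate parent x) lag-grandchild ⟩
    parent (parent x)                                 ≡⟨ cong parent (parent-child c c→x) ⟩
    parent c                                          ≡⟨ parent-child u u→c ⟩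
    u                                                 ∎
    where open ≡-Reasoning

-- Counting

∣p-x∣<∣p∣ : ∀ {n} {p : Subset n} {x} → x ∈ p → ∣ p - x ∣ < ∣ p ∣
∣p-x∣<∣p∣ {p = p} {x} x∈p = p⊂q⇒∣p∣<∣q∣ (p∩q≢∅⇒p─q⊂p p ⁅ x ⁆ (x , x∈p∩q⁺ (x∈p , x∈⁅x⁆ x)))

g[p]⊆f[q]⇒∣p∣≤∣q∣ : ∀ {m n} {A : Set} {p : Subset n} {q : Subset m} (f : Fin m → A) (g : Fin n → A) →
  Injective _≡_ _≡_ g → (∀ {i} → i ∈ p → ∃[ w ] w ∈ q × f w ≡ g i) → ∣ p ∣ ≤ ∣ q ∣
g[p]⊆f[q]⇒∣p∣≤∣q∣ {p = []} _ _ _ _ = z≤n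
g[p]⊆f[q]⇒∣p∣≤∣q∣ {p = outside ∷ p} f g g-inj cover =
  g[p]⊆f[q]⇒∣p∣≤∣q∣ f (g ∘ suc) (Finₚ.suc-injective ∘ g-inj) (cover ∘ there)
g[p]⊆f[q]⇒∣p∣≤∣q∣ {p = inside ∷ p} {q} f g g-inj cover with cover here
... | w₀ , w₀∈q , fw₀≡g0 =
  ≤-trans (s≤s (g[p]⊆f[q]⇒∣p∣≤∣q∣ f (g ∘ suc) (Finₚ.suc-injective ∘ g-inj) cover′)) (∣p-x∣<∣p∣ w₀∈q)
  where
  cover′ : ∀ {i} → i ∈ p → ∃[ w ] w ∈ q - w₀ × f w ≡ g (suc i)
  cover′ i∈p with cover (there i∈p)
  ... | w , w∈q , fw≡gi = w , x∈p∧x∉q⇒x∈p─q w∈q (x≢y⇒x∉⁅y⁆ w≢w₀) , fw≡gi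
    where
    w≢w₀ : w ≢ w₀
    w≢w₀ refl = Finₚ.0≢1+n (g-inj (trans (sym fw₀≡g0) fw≡gi))

select : ∀ {n} {P : Pred (Fin n) 0ℓ} → Decidable P → Subset n
select P? = tabulate (does ∘ P?)

∈-select⁺ : ∀ {n} {P : Pred (Fin n) 0ℓ} (P? : Decidable P) {i} → P i → i ∈ select P?
∈-select⁺ P? {i} Pi = lookup⇒[]= i _ (trans (lookup∘tabulate (does ∘ P?) i) (dec-true (P? i) Pi))

∈-select⁻ : ∀ {n} {P : Pred (Fin n) 0ℓ} (P? : Decidable P) {i} → i ∈ select P? → P i
∈-select⁻ P? {i} i∈ with P? i | trans (sym (lookup∘tabulate (does ∘ P?) i)) ([]=⇒lookup i∈)
... | yes Pi | _ = Pi
... | no _   | ()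

count : (ℕ → Bool) → ℕ → ℕ
count g zero    = 0
count g (suc n) = (if g 0 then 1 else 0) + count (g ∘ suc) n

∣tabulate∣≡count : ∀ n (g : ℕ → Bool) → ∣ tabulate {n = n} (g ∘ toℕ) ∣ ≡ count g n
∣tabulate∣≡count zero    g = refl
∣tabulate∣≡count (suc n) g with g 0
... | true  = cong suc (∣tabulate∣≡count n (g ∘ suc))
... | false = ∣tabulate∣≡count n (g ∘ suc)

count-+ : ∀ g m n → count g (m + n) ≡ count g m + count (λ x → g (m + x)) n
count-+ g zero    n = refl
count-+ g (suc m) n =
  trans (cong (_ +_) (count-+ (g ∘ suc) m n)) (sym (+-assoc (if g 0 then 1 else 0) _ _))

count-constant : ∀ g b n → (∀ x → x < n → g x ≡ b) → count g n ≡ (if b then n else 0)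
count-constant g true  zero    _   = refl
count-constant g false zero    _   = refl
count-constant g true  (suc n) g≡b rewrite g≡b 0 z<s =
  cong suc (count-constant (g ∘ suc) true n λ x → g≡b (suc x) ∘ s<s)
count-constant g false (suc n) g≡b rewrite g≡b 0 z<s =
  count-constant (g ∘ suc) false n λ x → g≡b (suc x) ∘ s<s

levelSum : (ℕ → Bool) → ℕ → ℕ
levelSum g zero    = 0
levelSum g (suc k) = levelSum g k + (if g k then 2 ^ k else 0)

2^[1+k]∸1≡[2^k∸1]+2^k : ∀ k → 2 ^ suc k ∸ 1 ≡ (2 ^ k ∸ 1) + 2 ^ k
2^[1+k]∸1≡[2^k∸1]+2^k k = begin
  2 * 2 ^ k ∸ 1          ≡⟨ cong (_∸ 1) (2*n≡n+n (2 ^ k)) ⟩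
  2 ^ k + 2 ^ k ∸ 1      ≡⟨ +-∸-comm (2 ^ k) (m^n>0 2 k) ⟩
  (2 ^ k ∸ 1) + 2 ^ k    ∎
  where open ≡-Reasoning

count∘depth≡levelSum : ∀ g K → count (g ∘ depth) (2 ^ K ∸ 1) ≡ levelSum g K
count∘depth≡levelSum g zero    = refl
count∘depth≡levelSum g (suc K) = begin
  count (g ∘ depth) (2 ^ suc K ∸ 1)
    ≡⟨ cong (count (g ∘ depth)) (2^[1+k]∸1≡[2^k∸1]+2^k K) ⟩
  count (g ∘ depth) ((2 ^ K ∸ 1) + 2 ^ K)
    ≡⟨ count-+ (g ∘ depth) (2 ^ K ∸ 1) (2 ^ K) ⟩
  count (g ∘ depth) (2 ^ K ∸ 1) + count (λ x → g (depth ((2 ^ K ∸ 1) + x))) (2 ^ K)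
    ≡⟨ cong₂ _+_ (count∘depth≡levelSum g K)
                 (count-constant _ (g K) (2 ^ K) (λ x x<2^K → cong g (depth-on-level K x x<2^K))) ⟩
  levelSum g (suc K)
    ∎
  where open ≡-Reasoning

sameResidue₃ : Fin 3 → ℕ → Bool
sameResidue₃ r k = does (residue₃ k Finₚ.≟ r)

-- Of the levels K, K + 1 and K + 2 only the first has the residue of K.
levelSum-+3 : ∀ K → let g = sameResidue₃ (residue₃ K) in levelSum g (3 + K) ≡ levelSum g K + 2 ^ K
levelSum-+3 K
  rewrite dec-true (residue₃ K Finₚ.≟ residue₃ K) refl
        | dec-false (next₃ (residue₃ K) Finₚ.≟ residue₃ K) (next₃x≢x (residue₃ K))
        | dec-false (next₃ (next₃ (residue₃ K)) Finₚ.≟ residue₃ K) (next₃²x≢x (residue₃ K))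
  = trans (+-identityʳ _) (+-identityʳ _)

7*levelSum+2^[K%3]≡2^K : ∀ K → 7 * levelSum (sameResidue₃ (residue₃ K)) K + 2 ^ (K % 3) ≡ 2 ^ K
7*levelSum+2^[K%3]≡2^K 0 = refl
7*levelSum+2^[K%3]≡2^K 1 = refl
7*levelSum+2^[K%3]≡2^K 2 = refl
7*levelSum+2^[K%3]≡2^K (suc (suc (suc K))) = begin
  7 * levelSum (sameResidue₃ (residue₃ (3 + K))) (3 + K) + 2 ^ ((3 + K) % 3)
    ≡⟨ cong₂ (λ r e → 7 * levelSum (sameResidue₃ r) (3 + K) + 2 ^ e) (next₃³≡id ρ) [3+K]%3≡K%3 ⟩
  7 * levelSum (sameResidue₃ ρ) (3 + K) + 2 ^ (K % 3)
    ≡⟨ cong (λ s → 7 * s + 2 ^ (K % 3)) (levelSum-+3 K) ⟩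
  7 * (L + 2 ^ K) + 2 ^ (K % 3)
    ≡⟨ regroup L (2 ^ K) (2 ^ (K % 3)) ⟩
  (7 * L + 2 ^ (K % 3)) + 7 * 2 ^ K
    ≡⟨ cong (_+ 7 * 2 ^ K) (7*levelSum+2^[K%3]≡2^K K) ⟩
  2 ^ K + 7 * 2 ^ K
    ≡⟨ n+7n≡2[2[2n]] (2 ^ K) ⟩
  2 ^ (3 + K)
    ∎
  where
  open ≡-Reasoning
  ρ = residue₃ K
  L = levelSum (sameResidue₃ ρ) K
  [3+K]%3≡K%3 : (3 + K) % 3 ≡ K % 3
  [3+K]%3≡K%3 = trans (cong (_% 3) (+-comm 3 K)) ([m+n]%n≡m%n K 3)
  regroup : ∀ l p t → 7 * (l + p) + t ≡ (7 * l + t) + 7 * p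
  regroup = solve-∀
  n+7n≡2[2[2n]] : ∀ n → n + 7 * n ≡ 2 * (2 * (2 * n))
  n+7n≡2[2[2n]] = solve-∀

[2^K∸2^[K%3]]/7≡levelSum : ∀ K → (2 ^ K ∸ 2 ^ (K % 3)) / 7 ≡ levelSum (sameResidue₃ (residue₃ K)) K
[2^K∸2^[K%3]]/7≡levelSum K = begin
  (2 ^ K ∸ 2 ^ (K % 3)) / 7          ≡⟨ cong (λ n → (n ∸ 2 ^ (K % 3)) / 7) (7*levelSum+2^[K%3]≡2^K K) ⟨
  (7 * L + 2 ^ (K % 3) ∸ 2 ^ (K % 3)) / 7 ≡⟨ cong (_/ 7) (m+n∸n≡m (7 * L) (2 ^ (K % 3))) ⟩
  7 * L / 7                          ≡⟨ cong (_/ 7) (*-comm 7 L) ⟩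
  L * 7 / 7                          ≡⟨ m*n/n≡m L 7 ⟩
  L                                  ∎
  where
  open ≡-Reasoning
  L = levelSum (sameResidue₃ (residue₃ K)) K

-- Every third level

module _ (h : ℕ) where

  OnThirdLevel : Pred (Fin (binTreeSize h)) 0ℓ
  OnThirdLevel i = residue₃ (depth (toℕ i)) ≡ residue₃ (h + 1)

  onThirdLevel? : Decidable OnThirdLevel
  onThirdLevel? i = residue₃ (depth (toℕ i)) Finₚ.≟ residue₃ (h + 1)

  everyThirdLevel : Subset (binTreeSize h)
  everyThirdLevel = select onThirdLevel?

  ∣everyThirdLevel∣ : ∣ everyThirdLevel ∣ ≡ (2 ^ (h + 1) ∸ 2 ^ ((h + 1) % 3)) / 7
  ∣everyThirdLevel∣ = begin
    ∣ everyThirdLevel ∣                          ≡⟨ ∣tabulate∣≡count (binTreeSize h) (g ∘ depth) ⟩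
    count (g ∘ depth) (binTreeSize h)            ≡⟨ count∘depth≡levelSum g (h + 1) ⟩
    levelSum g (h + 1)                           ≡⟨ [2^K∸2^[K%3]]/7≡levelSum (h + 1) ⟨
    (2 ^ (h + 1) ∸ 2 ^ ((h + 1) % 3)) / 7        ∎
    where
    open ≡-Reasoning
    g = sameResidue₃ (residue₃ (h + 1))

  ∈everyThirdLevel⁺ : ∀ {i} → OnThirdLevel i → i ∈ everyThirdLevel
  ∈everyThirdLevel⁺ = ∈-select⁺ onThirdLevel?

  ∈everyThirdLevel⁻ : ∀ {i} → i ∈ everyThirdLevel → OnThirdLevel i
  ∈everyThirdLevel⁻ = ∈-select⁻ onThirdLevel?

  everyThirdLevel-isClawDeletionSet : IsClawDeletionSet (FullBinaryTree h) everyThirdLevel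
  everyThirdLevel-isClawDeletionSet claw
    with parent-and-child-among (_∉ everyThirdLevel) ca cb cd a≢b a≢d b≢d a∉S b∉S d∉S
    where open InducedClawAvoiding claw
  ... | (p , p→c , p∉S) , (w , c→w , w∉S) =
    [ p∉S ∘ ∈everyThirdLevel⁺
    , [ c∉S ∘ ∈everyThirdLevel⁺ ∘ trans (cong residue₃ depth-c)
      , w∉S ∘ ∈everyThirdLevel⁺ ∘ trans (cong residue₃ depth-w) ] ]
    (one-of-three-hits (residue₃ (depth (toℕ p))) (residue₃ (h + 1)))
    where
    open InducedClawAvoiding claw
    depth-c : depth (toℕ c) ≡ suc (depth (toℕ p))
    depth-c = depth-child (toℕ p) p→c
    depth-w : depth (toℕ w) ≡ 2 + depth (toℕ p)
    depth-w = trans (depth-child (toℕ c) c→w) (cong suc depth-c)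

  child : (p : Fin (binTreeSize h)) → suc (depth (toℕ p)) ≤ h →
          ∀ x → IsChild (toℕ p) x → Fin (binTreeSize h)
  child p shallow x p→x =
    fromℕ< (depth≤⇒<binTreeSize h x (subst (_≤ h) (sym (depth-child (toℕ p) p→x)) shallow))

  toℕ-child : ∀ p shallow x (p→x : IsChild (toℕ p) x) → toℕ (child p shallow x p→x) ≡ x
  toℕ-child p shallow x p→x = toℕ-fromℕ< _

  child-isChild : ∀ p shallow x (p→x : IsChild (toℕ p) x) → ChildOf p (child p shallow x p→x)
  child-isChild p shallow x p→x = subst (IsChild (toℕ p)) (sym (toℕ-child p shallow x p→x)) p→x

  module ClawBelow (u : Fin (binTreeSize h)) (deep : 2 + depth (toℕ u) ≤ h) where

    u-shallow : suc (depth (toℕ u)) ≤ h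
    u-shallow = ≤-trans (n≤1+n _) deep

    c : Fin (binTreeSize h)
    c = child u u-shallow (2 * toℕ u + 1) (inj₁ refl)

    u→c : ChildOf u c
    u→c = child-isChild u u-shallow (2 * toℕ u + 1) (inj₁ refl)

    c-shallow : suc (depth (toℕ c)) ≤ h
    c-shallow = subst (λ k → suc k ≤ h) (sym (depth-child (toℕ u) u→c)) deep

    b d : Fin (binTreeSize h)
    b = child c c-shallow (2 * toℕ c + 1) (inj₁ refl)
    d = child c c-shallow (2 * toℕ c + 2) (inj₂ refl)

    c→b : ChildOf c b
    c→b = child-isChild c c-shallow (2 * toℕ c + 1) (inj₁ refl)

    c→d : ChildOf c d
    c→d = child-isChild c c-shallow (2 * toℕ c + 2) (inj₂ refl)

    b≢d : b ≢ d
    b≢d b≡d = contradiction (+-cancelˡ-≡ (2 * toℕ c) 1 2 (begin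
      2 * toℕ c + 1   ≡⟨ toℕ-child c c-shallow _ (inj₁ refl) ⟨
      toℕ b           ≡⟨ cong toℕ b≡d ⟩
      toℕ d           ≡⟨ toℕ-child c c-shallow _ (inj₂ refl) ⟩
      2 * toℕ c + 2   ∎)) λ ()
      where open ≡-Reasoning

  everyThirdLevel-minimum : ∀ S → IsClawDeletionSet (FullBinaryTree h) S → ∣ everyThirdLevel ∣ ≤ ∣ S ∣
  everyThirdLevel-minimum S noClaw = g[p]⊆f[q]⇒∣p∣≤∣q∣ (anchor r ∘ toℕ) toℕ toℕ-injective cover
    where
    r = residue₃ (h + 1)
    cover : ∀ {u} → u ∈ everyThirdLevel → ∃[ w ] w ∈ S × anchor r (toℕ w) ≡ toℕ u
    cover {u} u∈ = some-member-of-four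
      (λ u∉S c∉S b∉S d∉S → noClaw (parent-and-grandchildren-claw u→c c→b c→d b≢d u∉S c∉S b∉S d∉S))
      (λ w → anchor r (toℕ w) ≡ toℕ u) (anchor-of-claw (toℕ u) u-level u→c c→b c→d)
      where
      u-level : residue₃ (depth (toℕ u)) ≡ r
      u-level = ∈everyThirdLevel⁻ u∈
      deep : 2 + depth (toℕ u) ≤ h
      deep = residue₃-gap (<binTreeSize⇒depth≤ h (toℕ<n u)) (trans u-level (cong residue₃ (+-comm h 1)))
      open ClawBelow u deep

theorem8 : (h : ℕ) → IsCdn (FullBinaryTree h) ((2 ^ (h + 1) ∸ 2 ^ ((h + 1) % 3)) / 7)
theorem8 h =
  (everyThirdLevel h , everyThirdLevel-isClawDeletionSet h , ∣everyThirdLevel∣ h) ,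
  λ S noClaw → subst (_≤ ∣ S ∣) (∣everyThirdLevel∣ h) (everyThirdLevel-minimum h S noClaw)
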